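{- Let $G=(V,E)$ be a finite undirected graph with maximal cliques enumerated as $\overline{C}_1,\ldots,\overline{C}_m$. For every maximal clique-partition $\mathcal{P}$ of $G$ there exists a configuration $\mathit{cfg}\in\Pi_{\mathit{mcp}}(G)$ with $\mathit{repr}(\mathit{cfg})=\mathcal{P}$.
   Context: A clique of $G$ is a nonempty subset of $V$ whose vertices are pairwise adjacent; it is maximal if it is not a proper subset of another clique. A clique-partition of $G$ is a partition of $V$ all of whose blocks are cliques; it is a maximal clique-partition if it does not contain two different cliques $C,C'$ such that $C\cup C'$ is a clique. Fix an enumeration $\overline{C}_1,\ldots,\overline{C}_m$ of all maximal cliques of $G$. A configuration is a list $[C_1,\ldots,C_m]$ where each $C_i$ is either empty or a clique of $G$, $C_i\subseteq\overline{C}_i$ for all $i$, and $\bigcup_{i=1}^m C_i=V$. For a configuration, $\mathit{repr}([C_1,\ldots,C_m]):=\{C_i\mid 1\le i\le m,\ C_i\neq\emptyset\}$. $\Pi_{\mathit{mcp}}(G)$ is the set of configurations $\mathit{cfg}$ such that $\mathit{repr}(\mathit{cfg})$ is a maximal clique-partition of $G$. -}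

module Defs where

open import Data.Nat using (ℕ)
open import Data.Fin using (Fin)
open import Data.Fin.Subset using (Subset; _∈_; _∉_; _⊆_; _⊂_; _∪_; Nonempty; Empty)
open import Data.Bool using (Bool; true; false)
open import Data.Product using (Σ; ∃; _×_; _,_)
open import Data.Sum using (_⊎_)
open import Relation.Nullary using (¬_)
open import Relation.Binary.PropositionalEquality using (_≡_; _≢_)
open import Function.Definitions using (Injective)

record Graph (n : ℕ) : Set where
  field
    adj     : Fin n → Fin n → Bool
    adj-sym : ∀ u v → adj u v ≡ adj v u
    adj-irr : ∀ u → adj u u ≡ false
open Graph public

module _ {n : ℕ} (G : Graph n) where

  IsClique : Subset n → Set
  IsClique C = Nonempty C × (∀ u v → u ∈ C → v ∈ C → u ≢ v → adj G u v ≡ true)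

  IsMaximalClique : Subset n → Set
  IsMaximalClique C = IsClique C × (∀ D → IsClique D → ¬ (C ⊂ D))

  IsMaxCliqueEnumeration : (m : ℕ) → (Fin m → Subset n) → Set
  IsMaxCliqueEnumeration m Cbar =
    (∀ i → IsMaximalClique (Cbar i))
    × (∀ C → IsMaximalClique C → ∃ λ i → Cbar i ≡ C)
    × Injective _≡_ _≡_ Cbar

  -- A family of subsets of V is given as a predicate  P : Subset n → Set
  -- (C is a block of the family iff P C holds).
  IsPartition : (Subset n → Set) → Set
  IsPartition P =
    (∀ C → P C → Nonempty C)
    × (∀ C D → P C → P D → C ≢ D → ∀ v → v ∈ C → v ∉ D)
    × (∀ v → ∃ λ C → P C × v ∈ C)

  IsCliquePartition : (Subset n → Set) → Set
  IsCliquePartition P = IsPartition P × (∀ C → P C → IsClique C)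

  IsMaximalCliquePartition : (Subset n → Set) → Set
  IsMaximalCliquePartition P =
    IsCliquePartition P
    × (∀ C D → P C → P D → C ≢ D → ¬ IsClique (C ∪ D))

  module _ {m : ℕ} (Cbar : Fin m → Subset n) where

    IsConfiguration : (Fin m → Subset n) → Set
    IsConfiguration cfg =
      (∀ i → Empty (cfg i) ⊎ IsClique (cfg i))
      × (∀ i → cfg i ⊆ Cbar i)
      × (∀ v → ∃ λ i → v ∈ cfg i)

    repr : (Fin m → Subset n) → Subset n → Set
    repr cfg C = (∃ λ i → cfg i ≡ C) × Nonempty C

    InΠmcp : (Fin m → Subset n) → Set
    InΠmcp cfg = IsConfiguration cfg × IsMaximalCliquePartition (repr cfg)

-- Every block of P is a clique, hence (extending it greedily to a maximal clique) lies in
-- some Cbar i. Conversely at most one block lies in a given Cbar i, because two distinct blocks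
-- inside one clique would have a clique as union, contradicting maximality of P. So putting
-- into the i-th slot the union of the blocks contained in Cbar i yields a configuration whose
-- nonempty entries are exactly the blocks of P.
module Submission where

open import Defs
open import Data.Nat using (ℕ)
open import Data.Fin using (Fin)
open import Data.Fin.Subset using (Subset; _∈_; _⊆_; _⊂_; _∪_; ⁅_⁆; Nonempty; Empty)
open import Data.Fin.Subset.Properties
  using (_∈?_; _⊆?_; ⊆-antisym; nonempty?; p⊆p∪q; x∈p∪q⁺; x∈p∪q⁻; x∈⁅x⁆; x∈⁅y⁆⇒x≡y)
open import Data.Fin.Properties using (all?)
open import Data.Bool using (true) renaming (_≟_ to _≟ᵇ_)
open import Data.Vec using (tabulate)
open import Data.Vec.Properties using (≡-dec; []=⇒lookup; lookup⇒[]=; lookup∘tabulate)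
open import Data.List using (List; []; _∷_; allFin)
open import Data.List.Membership.Propositional using () renaming (_∈_ to _∈ˡ_)
open import Data.List.Membership.Propositional.Properties using (∈-allFin)
open import Data.List.Relation.Unary.Any using (here; there)
open import Data.Product using (Σ; ∃; _×_; _,_; proj₁; proj₂)
open import Data.Sum using (_⊎_; inj₁; inj₂)
open import Function.Base using (_∘_)
open import Function.Bundles using (_⇔_; mk⇔; Equivalence)
open import Relation.Binary.PropositionalEquality using (_≡_; _≢_; refl; sym; trans; subst)
open import Relation.Nullary using (¬_; Dec; yes; no; does; contradiction)
open import Relation.Nullary.Decidable using (_→-dec_; dec-true)
open import Relation.Unary using (Pred; Decidable)

_≟ˢ_ : ∀ {n} (p q : Subset n) → Dec (p ≡ q)
_≟ˢ_ = ≡-dec _≟ᵇ_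

∪-least : ∀ {n} {p q r : Subset n} → p ⊆ r → q ⊆ r → p ∪ q ⊆ r
∪-least {p = p} {q} p⊆r q⊆r x∈p∪q with x∈p∪q⁻ p q x∈p∪q
... | inj₁ x∈p = p⊆r x∈p
... | inj₂ x∈q = q⊆r x∈q

module _ {n ℓ} {P : Pred (Fin n) ℓ} (P? : Decidable P) where

  subsetOf : Subset n
  subsetOf = tabulate λ x → does (P? x)

  ∈-subsetOf⁺ : ∀ {x} → P x → x ∈ subsetOf
  ∈-subsetOf⁺ {x} px = lookup⇒[]= x subsetOf (trans (lookup∘tabulate _ x) (dec-true (P? x) px))

  ∈-subsetOf⁻ : ∀ {x} → x ∈ subsetOf → P x
  ∈-subsetOf⁻ {x} x∈ with P? x | trans (sym (lookup∘tabulate _ x)) ([]=⇒lookup x∈)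
  ... | yes px | _ = px
  ... | no _   | ()

module _ {n : ℕ} (G : Graph n) where

  clique-⊆ : ∀ {C K} → IsClique G K → Nonempty C → C ⊆ K → IsClique G C
  clique-⊆ (_ , adjacent) C≠∅ C⊆K = C≠∅ , λ u v u∈C v∈C → adjacent u v (C⊆K u∈C) (C⊆K v∈C)

  AdjacentToAll : Fin n → Subset n → Set
  AdjacentToAll u C = ∀ w → w ∈ C → adj G u w ≡ true

  adjacentToAll? : ∀ u C → Dec (AdjacentToAll u C)
  adjacentToAll? u C = all? λ w → w ∈? C →-dec adj G u w ≟ᵇ true

  clique-∪-⁅⁆ : ∀ {u C} → IsClique G C → AdjacentToAll u C → IsClique G (C ∪ ⁅ u ⁆)
  clique-∪-⁅⁆ {u} {C} (_ , adjacent) u~C = (u , x∈p∪q⁺ (inj₂ (x∈⁅x⁆ u))) , adjacent′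
    where
    adjacent′ : ∀ x y → x ∈ C ∪ ⁅ u ⁆ → y ∈ C ∪ ⁅ u ⁆ → x ≢ y → adj G x y ≡ true
    adjacent′ x y x∈ y∈ x≢y with x∈p∪q⁻ C _ x∈ | x∈p∪q⁻ C _ y∈
    ... | inj₁ x∈C | inj₁ y∈C = adjacent x y x∈C y∈C x≢y
    ... | inj₁ x∈C | inj₂ y≡u rewrite x∈⁅y⁆⇒x≡y u y≡u = trans (adj-sym G x u) (u~C x x∈C)
    ... | inj₂ x≡u | inj₁ y∈C rewrite x∈⁅y⁆⇒x≡y u x≡u = u~C y y∈C
    ... | inj₂ x≡u | inj₂ y≡u = contradiction (trans (x∈⁅y⁆⇒x≡y u x≡u) (sym (x∈⁅y⁆⇒x≡y u y≡u))) x≢y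

  insertIfAdjacent : Fin n → Subset n → Subset n
  insertIfAdjacent u C with adjacentToAll? u C
  ... | yes _ = C ∪ ⁅ u ⁆
  ... | no _  = C

  greedyExtend : List (Fin n) → Subset n → Subset n
  greedyExtend []       C = C
  greedyExtend (u ∷ us) C = greedyExtend us (insertIfAdjacent u C)

  ⊆-insertIfAdjacent : ∀ u C → C ⊆ insertIfAdjacent u C
  ⊆-insertIfAdjacent u C with adjacentToAll? u C
  ... | yes _ = p⊆p∪q _
  ... | no _  = λ x∈C → x∈C

  ⊆-greedyExtend : ∀ us C → C ⊆ greedyExtend us C
  ⊆-greedyExtend []       C x∈C = x∈C
  ⊆-greedyExtend (u ∷ us) C x∈C = ⊆-greedyExtend us _ (⊆-insertIfAdjacent u C x∈C)

  insertIfAdjacent-clique : ∀ u {C} → IsClique G C → IsClique G (insertIfAdjacent u C)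
  insertIfAdjacent-clique u {C} C-clique with adjacentToAll? u C
  ... | yes u~C = clique-∪-⁅⁆ C-clique u~C
  ... | no _    = C-clique

  greedyExtend-clique : ∀ us {C} → IsClique G C → IsClique G (greedyExtend us C)
  greedyExtend-clique []       C-clique = C-clique
  greedyExtend-clique (u ∷ us) C-clique = greedyExtend-clique us (insertIfAdjacent-clique u C-clique)

  Rejected : Fin n → Subset n → Set
  Rejected u C = u ∈ C ⊎ ¬ AdjacentToAll u C

  Rejected-⊆ : ∀ {u A B} → A ⊆ B → Rejected u A → Rejected u B
  Rejected-⊆ A⊆B (inj₁ u∈A) = inj₁ (A⊆B u∈A)
  Rejected-⊆ A⊆B (inj₂ u≁A) = inj₂ λ u~B → u≁A λ w w∈A → u~B w (A⊆B w∈A)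

  insertIfAdjacent-rejected : ∀ u C → Rejected u (insertIfAdjacent u C)
  insertIfAdjacent-rejected u C with adjacentToAll? u C
  ... | yes _    = inj₁ (x∈p∪q⁺ (inj₂ (x∈⁅x⁆ u)))
  ... | no u≁C = inj₂ u≁C

  greedyExtend-rejected : ∀ {u} us C → u ∈ˡ us → Rejected u (greedyExtend us C)
  greedyExtend-rejected (u ∷ us) C (here refl) =
    Rejected-⊆ (⊆-greedyExtend us _) (insertIfAdjacent-rejected u C)
  greedyExtend-rejected (_ ∷ us) C (there u∈us) = greedyExtend-rejected us _ u∈us

  allRejected⇒maximal : ∀ {R} → IsClique G R → (∀ u → Rejected u R) → IsMaximalClique G R
  allRejected⇒maximal {R} R-clique rejected = R-clique , not⊂
    where
    not⊂ : ∀ D → IsClique G D → ¬ (R ⊂ D)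
    not⊂ D (_ , adjacent) (R⊆D , u , u∈D , u∉R) with rejected u
    ... | inj₁ u∈R = u∉R u∈R
    ... | inj₂ u≁R = u≁R λ w w∈R → adjacent u w u∈D (R⊆D w∈R) λ { refl → u∉R w∈R }

  clique⊆maximalClique : ∀ {C} → IsClique G C → ∃ λ D → C ⊆ D × IsMaximalClique G D
  clique⊆maximalClique {C} C-clique =
    greedyExtend (allFin n) C ,
    ⊆-greedyExtend (allFin n) C ,
    allRejected⇒maximal (greedyExtend-clique (allFin n) C-clique)
                         (λ u → greedyExtend-rejected (allFin n) C (∈-allFin u))

  partition-block-unique : ∀ {P C D v} → IsPartition G P → P C → P D → v ∈ C → v ∈ D → C ≡ D
  partition-block-unique {C = C} {D} (_ , disjoint , _) PC PD v∈C v∈D with C ≟ˢ D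
  ... | yes C≡D = C≡D
  ... | no C≢D  = contradiction v∈D (disjoint C D PC PD C≢D _ v∈C)

  maximalCliquePartition-block-unique : ∀ {P C D K} → IsMaximalCliquePartition G P →
    P C → P D → IsClique G K → C ⊆ K → D ⊆ K → C ≡ D
  maximalCliquePartition-block-unique {C = C} {D} (((nonempty , _) , _) , unmergeable)
    PC PD K-clique C⊆K D⊆K with C ≟ˢ D
  ... | yes C≡D = C≡D
  ... | no C≢D  = contradiction (clique-⊆ K-clique C∪D≠∅ (∪-least C⊆K D⊆K)) (unmergeable C D PC PD C≢D)
    where
    C∪D≠∅ : Nonempty (C ∪ D)
    C∪D≠∅ = let v , v∈C = nonempty C PC in v , x∈p∪q⁺ (inj₁ v∈C)

  maximalCliquePartition-resp-⇔ : ∀ {P Q} → (∀ C → Q C ⇔ P C) →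
    IsMaximalCliquePartition G P → IsMaximalCliquePartition G Q
  maximalCliquePartition-resp-⇔ {P} {Q} Q⇔P (((nonempty , disjoint , covers) , cliques) , unmergeable) =
    (( (λ C → nonempty C ∘ toP C)
     , (λ C D QC QD → disjoint C D (toP C QC) (toP D QD))
     , covers′)
    , (λ C → cliques C ∘ toP C)) ,
    λ C D QC QD → unmergeable C D (toP C QC) (toP D QD)
    where
    toP : ∀ C → Q C → P C
    toP C = Equivalence.to (Q⇔P C)
    covers′ : ∀ v → ∃ λ C → Q C × v ∈ C
    covers′ v = let C , PC , v∈C = covers v in C , Equivalence.from (Q⇔P C) PC , v∈C

module Realisation {n : ℕ} (G : Graph n) {m : ℕ} (Cbar : Fin m → Subset n)
  (enumeration : IsMaxCliqueEnumeration G m Cbar)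
  (P : Subset n → Set) (mcp : IsMaximalCliquePartition G P) where

  clique⊆Cbar : ∀ {C} → IsClique G C → ∃ λ i → C ⊆ Cbar i
  clique⊆Cbar C-clique with clique⊆maximalClique G C-clique
  ... | D , C⊆D , D-maximal with proj₁ (proj₂ enumeration) D D-maximal
  ...   | i , refl = i , C⊆D

  partition : IsPartition G P
  partition = proj₁ (proj₁ mcp)

  block : Fin n → Subset n
  block v = proj₁ (proj₂ (proj₂ partition) v)

  P-block : ∀ v → P (block v)
  P-block v = proj₁ (proj₂ (proj₂ (proj₂ partition) v))

  ∈-block : ∀ v → v ∈ block v
  ∈-block v = proj₂ (proj₂ (proj₂ (proj₂ partition) v))

  block-clique : ∀ v → IsClique G (block v)
  block-clique v = proj₂ (proj₁ mcp) _ (P-block v)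

  block-unique : ∀ {C v} → P C → v ∈ C → block v ≡ C
  block-unique PC v∈C = partition-block-unique G partition (P-block _) PC (∈-block _) v∈C

  index : Fin n → Fin m
  index v = proj₁ (clique⊆Cbar (block-clique v))

  block⊆Cbar-index : ∀ v → block v ⊆ Cbar (index v)
  block⊆Cbar-index v = proj₂ (clique⊆Cbar (block-clique v))

  -- The union of the blocks contained in Cbar i; by maximality there is at most one of them.
  configuration : Fin m → Subset n
  configuration i = subsetOf λ v → block v ⊆? Cbar i

  ∈-configuration⁺ : ∀ {i v} → block v ⊆ Cbar i → v ∈ configuration i
  ∈-configuration⁺ {i} = ∈-subsetOf⁺ λ v → block v ⊆? Cbar i

  ∈-configuration⁻ : ∀ {i v} → v ∈ configuration i → block v ⊆ Cbar i
  ∈-configuration⁻ {i} = ∈-subsetOf⁻ λ v → block v ⊆? Cbar i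

  configuration≡block : ∀ {i w} → block w ⊆ Cbar i → configuration i ≡ block w
  configuration≡block {i} {w} w⊆Cbar = ⊆-antisym ⊆block block⊆
    where
    ⊆block : configuration i ⊆ block w
    ⊆block {v} v∈ = subst (v ∈_) same (∈-block v)
      where
      same : block v ≡ block w
      same = maximalCliquePartition-block-unique G mcp (P-block v) (P-block w)
               (proj₁ (proj₁ enumeration i)) (∈-configuration⁻ v∈) w⊆Cbar
    block⊆ : block w ⊆ configuration i
    block⊆ v∈w = ∈-configuration⁺ (subst (_⊆ Cbar i) (sym (block-unique (P-block w) v∈w)) w⊆Cbar)

  ∈-configuration⇒≡block : ∀ {i v} → v ∈ configuration i → configuration i ≡ block v
  ∈-configuration⇒≡block v∈ = configuration≡block (∈-configuration⁻ v∈)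

  isConfiguration : IsConfiguration G Cbar configuration
  isConfiguration = emptyOrClique , ⊆Cbar , λ v → index v , ∈-configuration⁺ (block⊆Cbar-index v)
    where
    emptyOrClique : ∀ i → Empty (configuration i) ⊎ IsClique G (configuration i)
    emptyOrClique i with nonempty? (configuration i)
    ... | yes (v , v∈) = inj₂ (subst (IsClique G) (sym (∈-configuration⇒≡block v∈)) (block-clique v))
    ... | no empty     = inj₁ empty
    ⊆Cbar : ∀ i → configuration i ⊆ Cbar i
    ⊆Cbar i {v} v∈ = ∈-configuration⁻ v∈ (∈-block v)

  repr⇔P : ∀ C → repr G Cbar configuration C ⇔ P C
  repr⇔P C = mk⇔ to from
    where
    to : repr G Cbar configuration C → P C
    to ((i , refl) , v , v∈) = subst P (sym (∈-configuration⇒≡block v∈)) (P-block v)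
    from : P C → repr G Cbar configuration C
    from PC = let v , v∈C = proj₁ partition C PC in
      (index v , trans (configuration≡block (block⊆Cbar-index v)) (block-unique PC v∈C)) , v , v∈C

lemma1 : (n : ℕ) (G : Graph n) (m : ℕ) (Cbar : Fin m → Subset n)
    → IsMaxCliqueEnumeration G m Cbar
    → (P : Subset n → Set)
    → IsMaximalCliquePartition G P
    → Σ (Fin m → Subset n) λ cfg
    → InΠmcp G Cbar cfg × (∀ C → repr G Cbar cfg C ⇔ P C)
lemma1 n G m Cbar enumeration P mcp =
  configuration , (isConfiguration , maximalCliquePartition-resp-⇔ G repr⇔P mcp) , repr⇔P
  where open Realisation G Cbar enumeration P mcp
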